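{- Let $(X,<,R)$ be a countable homogeneous ordered bipartite graph, i.e. $<$ is a linear order on $X$, $X$ is partitioned into a set of "red" points and a set of "blue" points, and $R$ is a symmetric graph relation each of whose edges joins a red point to a blue point. Then, as a 2-coloured linear order (forgetting $R$), $(X,<)$ is isomorphic to one of the following: (I) Degenerate cases: (i) a singleton, or a doubleton each point of colour red or blue (and one of each); (ii) $(\mathbb{Q},<)$ monochromatically coloured (all red or all blue); (iii) $(\mathbb{Q}\cup\{\infty\},<)$ or $(\mathbb{Q}\cup\{ -\infty\},<)$, with $\mathbb{Q}$ coloured by one of the colours and the added endpoint coloured by the other. (II) Non-degenerate cases: (iv) $(2.\mathbb{Q},<)$, with one copy of $\mathbb{Q}$ coloured by one colour and the other copy by the other colour; (v) $(\mathbb{Q}.2,<)$, with each adjacent pair coloured the same way, either (red, blue) or (blue, red); (vi) the generic 2-coloured linear order $\mathbb{Q}_2$.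
   Context: The structure $(X,<,R)$ is regarded as a relational structure with the linear order $<$, the binary relation $R$, and two unary predicates "red" and "blue" partitioning $X$; isomorphisms and automorphisms must preserve all of these (in particular colours). It is homogeneous if every isomorphism between finite substructures extends to an automorphism of the whole structure. $2.\mathbb{Q}$ denotes the linear order consisting of a copy of $\mathbb{Q}$ followed by (entirely below) another copy of $\mathbb{Q}$. $\mathbb{Q}.2$ denotes $\mathbb{Q}\times\{0,1\}$ ordered lexicographically, i.e. a $\mathbb{Q}$-indexed family of 2-element chains; "each adjacent pair coloured (red, blue)" means each $(q,0)$ is red and each $(q,1)$ is blue (and analogously for (blue, red)). $\mathbb{Q}_2$ is the countable dense linear order without endpoints in which each point is coloured red or blue and between any two points there are points of both colours (unique up to isomorphism). -}

module Defs where

open import Level using (0ℓ)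
open import Data.Nat using (ℕ)
open import Data.Fin as Fin using (Fin; zero; suc)
open import Data.Rational as ℚ using (ℚ)
open import Data.Sum using (_⊎_; inj₁; inj₂)
open import Data.Product using (Σ; Σ-syntax; ∃; _×_; _,_)
open import Data.Unit using (⊤; tt)
open import Data.Empty using (⊥)
open import Relation.Binary.PropositionalEquality using (_≡_; _≢_)
open import Relation.Binary.Structures using (IsStrictTotalOrder)
open import Function.Definitions using (Injective; Bijective)
open import Function.Bundles using (_⇔_)

data Colour : Set where
  red blue : Colour

other : Colour → Colour
other red  = blue
other blue = red

record ColOrd : Set₁ where
  field
    Carrier : Set
    _≺_     : Carrier → Carrier → Set
    colour  : Carrier → Colour

record ColIso (A B : ColOrd) : Set where
  private
    module A = ColOrd A
    module B = ColOrd B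
  field
    f          : A.Carrier → B.Carrier
    bijective  : Bijective _≡_ _≡_ f
    pres-≺     : ∀ x y → (x A.≺ y) ⇔ (f x B.≺ f y)
    pres-col   : ∀ x → B.colour (f x) ≡ A.colour x

record OrderedBipartiteGraph : Set₁ where
  field
    X                  : Set
    _<_                : X → X → Set
    R                  : X → X → Set
    colour             : X → Colour
    isStrictTotalOrder : IsStrictTotalOrder _≡_ _<_
    R-sym              : ∀ {x y} → R x y → R y x
    R-bipartite        : ∀ {x y} → R x y → colour x ≢ colour y

  colOrd : ColOrd
  colOrd = record { Carrier = X ; _≺_ = _<_ ; colour = colour }

  Countable : Set
  Countable = Σ (X → ℕ) (Injective _≡_ _≡_)

  -- a_i ↦ b_i (i < n) is an isomorphism between the finite substructures
  -- {a_0..a_{n-1}} and {b_0..b_{n-1}} (well defined, injective, preserving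
  -- <, R and colours in both directions)
  IsFinitePartialIso : {n : ℕ} → (a b : Fin n → X) → Set
  IsFinitePartialIso a b =
      (∀ i j → (a i ≡ a j) ⇔ (b i ≡ b j))
    × (∀ i j → (a i < a j) ⇔ (b i < b j))
    × (∀ i j → R (a i) (a j) ⇔ R (b i) (b j))
    × (∀ i → colour (b i) ≡ colour (a i))

  record Automorphism : Set where
    field
      σ         : X → X
      bijective : Bijective _≡_ _≡_ σ
      pres-<    : ∀ x y → (x < y) ⇔ (σ x < σ y)
      pres-R    : ∀ x y → R x y ⇔ R (σ x) (σ y)
      pres-col  : ∀ x → colour (σ x) ≡ colour x

  Homogeneous : Set
  Homogeneous = ∀ (n : ℕ) (a b : Fin n → X) → IsFinitePartialIso a b →
    Σ[ s ∈ Automorphism ] (∀ i → Automorphism.σ s (a i) ≡ b i)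

Single : Colour → ColOrd
Single c = record { Carrier = Fin 1 ; _≺_ = Fin._<_ ; colour = λ _ → c }

Double : Colour → ColOrd
Double c = record { Carrier = Fin 2 ; _≺_ = Fin._<_ ; colour = col }
  where
  col : Fin 2 → Colour
  col zero    = c
  col (suc _) = other c

QMono : Colour → ColOrd
QMono c = record { Carrier = ℚ ; _≺_ = ℚ._<_ ; colour = λ _ → c }

_⊕_ : ColOrd → ColOrd → ColOrd
A ⊕ B = record { Carrier = A.Carrier ⊎ B.Carrier ; _≺_ = lt ; colour = col }
  where
  module A = ColOrd A
  module B = ColOrd B
  lt : A.Carrier ⊎ B.Carrier → A.Carrier ⊎ B.Carrier → Set
  lt (inj₁ x) (inj₁ y) = x A.≺ y
  lt (inj₁ _) (inj₂ _) = ⊤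
  lt (inj₂ _) (inj₁ _) = ⊥
  lt (inj₂ x) (inj₂ y) = x B.≺ y
  col : A.Carrier ⊎ B.Carrier → Colour
  col (inj₁ x) = A.colour x
  col (inj₂ y) = B.colour y

QPlusTop : Colour → ColOrd
QPlusTop c = QMono c ⊕ Single (other c)

QPlusBot : Colour → ColOrd
QPlusBot c = Single (other c) ⊕ QMono c

TwoQ : Colour → ColOrd
TwoQ c = QMono c ⊕ QMono (other c)

QTwo : Colour → ColOrd
QTwo c = record { Carrier = ℚ × Fin 2 ; _≺_ = lt ; colour = col }
  where
  lt : ℚ × Fin 2 → ℚ × Fin 2 → Set
  lt (p , i) (q , j) = (p ℚ.< q) ⊎ ((p ≡ q) × (i Fin.< j))
  col : ℚ × Fin 2 → Colour
  col (_ , zero)  = c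
  col (_ , suc _) = other c

-- a colouring of ℚ in which between any two points there are points of
-- both colours; (ℚ,<,χ) is then the generic 2-coloured order ℚ₂
IsGenericColouring : (ℚ → Colour) → Set
IsGenericColouring χ = ∀ p q → p ℚ.< q → ∀ c →
  Σ[ r ∈ ℚ ] (p ℚ.< r × r ℚ.< q × χ r ≡ c)

QCol : (ℚ → Colour) → ColOrd
QCol χ = record { Carrier = ℚ ; _≺_ = ℚ._<_ ; colour = χ }

_≅_ : ColOrd → ColOrd → Set
A ≅ B = ColIso A B

OneOfTheListedOrders : ColOrd → Set
OneOfTheListedOrders A =
    (Σ[ c ∈ Colour ] A ≅ Single c)
  ⊎ (Σ[ c ∈ Colour ] A ≅ Double c)
  ⊎ (Σ[ c ∈ Colour ] A ≅ QMono c)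
  ⊎ (Σ[ c ∈ Colour ] A ≅ QPlusTop c)
  ⊎ (Σ[ c ∈ Colour ] A ≅ QPlusBot c)
  ⊎ (Σ[ c ∈ Colour ] A ≅ TwoQ c)
  ⊎ (Σ[ c ∈ Colour ] A ≅ QTwo c)
  ⊎ (Σ[ χ ∈ (ℚ → Colour) ] (IsGenericColouring χ × A ≅ QCol χ))

{-# OPTIONS --safe #-}
-- Homogeneity makes the automorphisms transitive on the points of each colour and on increasing
-- pairs of points of one colour: there are no edges inside a colour class, so order and colour
-- alone describe such a partial isomorphism. Hence a colour class with two points is dense without
-- endpoints, so isomorphic to ℚ by Cantor's back-and-forth argument, while a class with a single
-- point is fixed by every automorphism, so the other class lies entirely on one side of it.
-- When both classes have two points, either one lies below the other (2.ℚ); or some point covers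
-- another, and transitivity makes every point of one colour covered by a point of the other (ℚ.2);
-- or the order is dense and each colour occurs between two points of the other, so every interval
-- contains both colours (ℚ₂).
module Submission where

open import Defs
open import Level using (0ℓ)
open import Axiom.ExcludedMiddle using (ExcludedMiddle)
open import Axiom.DoubleNegationElimination using (em⇒dne)
open import Axiom.UniquenessOfIdentityProofs using (module Decidable⇒UIP)
open import Data.Nat as ℕ using (ℕ; zero; suc; _≤′_; _⊔_)
open import Data.Nat.Properties using (≤⇒≤′; m≤m⊔n; m≤n⊔m)
open import Data.Nat.Binary as ℕᵇ using (ℕᵇ; 2[1+_]; 1+[2_])
open import Data.Nat.Binary.Properties as ℕᵇ using (2[1+_]-injective; 1+[2_]-injective; fromℕ-injective)
open import Data.Integer using (ℤ; +_; -[1+_])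
open import Data.Rational as ℚ using (ℚ; mkℚ)
import Data.Rational.Properties as ℚ
open import Data.Product using (Σ; Σ-syntax; ∃; ∃-syntax; _×_; _,_; proj₁; proj₂; swap)
open import Data.Sum as Sum using (_⊎_; inj₁; inj₂)
open import Data.Sum.Function.Propositional using (_⊎-⤖_)
open import Data.Empty using (⊥-elim)
open import Data.Unit using (tt)
open import Data.Fin using (Fin; zero; suc)
open import Data.Maybe using (Maybe; just; nothing)
open import Data.List using (List; []; _∷_; map; filter)
open import Data.List.Relation.Unary.All as All using (All; []; _∷_)
open import Data.List.Relation.Unary.Any using (here; there)
open import Data.List.Membership.Propositional using (_∈_)
open import Data.List.Membership.Propositional.Properties using (∈-map⁺; ∈-map⁻; ∈-map∘filter⁺; ∈-map∘filter⁻)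
import Data.List.Membership.DecPropositional as DecMembership
open import Data.List.Relation.Binary.Subset.Propositional using (_⊆_)
open import Data.List.Relation.Binary.Subset.Propositional.Properties using (∈-∷⁺ʳ)
open import Relation.Nullary using (¬_; Dec; yes; no)
open import Relation.Binary.Core using (Rel)
open import Relation.Binary.Definitions using (DecidableEquality; Trichotomous; tri<; tri≈; tri>)
open import Relation.Binary.Structures using (IsStrictTotalOrder; IsDenseLinearOrder)
open import Relation.Binary.Structures.Biased using (isStrictTotalOrderᶜ)
open import Relation.Binary.Morphism.Structures using (IsOrderIsomorphism)
open import Relation.Binary.PropositionalEquality as ≡ using (_≡_; _≢_; refl; sym; cong; subst; subst₂)
open import Function.Base using (id; _∘_)
open import Function.Bundles using (_⇔_; mk⇔; Equivalence; Bijection; mk⤖)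
import Function.Construct.Composition as Compose
open import Function.Definitions using (Injective; StrictlySurjective)
open import Function.Consequences.Propositional using (strictlySurjective⇒surjective; surjective⇒strictlySurjective)
import Function.Properties.Equivalence as ⇔

module _ {A B : Set} {_<₁_ : Rel A 0ℓ} {_<₂_ : Rel B 0ℓ} (sto : IsStrictTotalOrder _≡_ _<₁_) {f : A → B} where
  open IsStrictTotalOrder sto using (compare; irrefl)

  isOrderIsomorphism : (∀ x y → x <₁ y ⇔ f x <₂ f y) → StrictlySurjective _≡_ f →
                       IsOrderIsomorphism _≡_ _≡_ _<₁_ _<₂_ f
  isOrderIsomorphism pres surjective = record
    { isOrderMonomorphism = record
      { isOrderHomomorphism = record { cong = cong f ; mono = mono }
      ; injective = injective
      ; cancel = cancel
      }
    ; surjective = strictlySurjective⇒surjective surjective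
    }
    where
    mono : ∀ {x y} → x <₁ y → f x <₂ f y
    mono {x} {y} = Equivalence.to (pres x y)
    cancel : ∀ {x y} → f x <₂ f y → x <₁ y
    cancel {x} {y} = Equivalence.from (pres x y)
    injective : Injective _≡_ _≡_ f
    injective {x} {y} fx≡fy with compare x y
    ... | tri< x<y _ _ = ⊥-elim (irrefl refl (cancel (subst (_<₂ f y) fx≡fy (mono x<y))))
    ... | tri≈ _ x≡y _ = x≡y
    ... | tri> _ _ y<x = ⊥-elim (irrefl refl (cancel (subst (f y <₂_) fx≡fy (mono y<x))))

record CountableDLO : Set₁ where
  field
    Carrier            : Set
    _<_                : Rel Carrier 0ℓ
    isDenseLinearOrder : IsDenseLinearOrder _≡_ _<_
    noMax              : ∀ x → ∃[ y ] x < y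
    noMin              : ∀ x → ∃[ y ] y < x
    point              : Carrier
    encode             : Carrier → ℕ
    encode-injective   : Injective _≡_ _≡_ encode

  open IsDenseLinearOrder isDenseLinearOrder public

  below-both : ∀ x y → ∃[ z ] z < x × z < y
  below-both x y with compare x y
  ... | tri< x<y _ _ = let z , z<x = noMin x in z , z<x , trans z<x x<y
  ... | tri≈ _ refl _ = let z , z<x = noMin x in z , z<x , z<x
  ... | tri> _ _ y<x = let z , z<y = noMin y in z , trans z<y y<x , z<y

  between-both : ∀ {l x y} → l < x → l < y → ∃[ z ] l < z × z < x × z < y
  between-both {l} {x} {y} l<x l<y with compare x y
  ... | tri< x<y _ _ = let z , l<z , z<x = dense l<x in z , l<z , z<x , trans z<x x<y
  ... | tri≈ _ refl _ = let z , l<z , z<x = dense l<x in z , l<z , z<x , z<x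
  ... | tri> _ _ y<x = let z , l<z , z<y = dense l<y in z , l<z , trans z<y y<x , z<y

  below-all : ∀ hs → ∃[ b ] All (b <_) hs
  below-all []       = point , []
  below-all (h ∷ hs) =
    let b , b<hs = below-all hs
        z , z<b , z<h = below-both b h
    in z , z<h ∷ All.map (trans z<b) b<hs

  above-below-all : ∀ {l} hs → All (l <_) hs → ∃[ b ] l < b × All (b <_) hs
  above-below-all {l} []       []           = let b , l<b = noMax l in b , l<b , []
  above-below-all     (h ∷ hs) (l<h ∷ l<hs) =
    let b , l<b , b<hs = above-below-all hs l<hs
        z , l<z , z<b , z<h = between-both l<b l<h
    in z , l<z , z<h ∷ All.map (trans z<b) b<hs

  above-all-below-all : ∀ {l ls} hs → All (_< l) ls → All (l <_) hs → ∃[ b ] All (_< b) (l ∷ ls) × All (b <_) hs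
  above-all-below-all hs ls<l l<hs =
    let b , l<b , b<hs = above-below-all hs l<hs
    in b , l<b ∷ All.map (λ x<l → trans x<l l<b) ls<l , b<hs

  interpolate : ∀ ls hs → All (λ l → All (l <_) hs) ls → ∃[ b ] All (_< b) ls × All (b <_) hs
  interpolate []       hs []              = let b , b<hs = below-all hs in b , [] , b<hs
  interpolate (l ∷ ls) hs (l<hs ∷ ls<hs) with interpolate ls hs ls<hs
  ... | b , ls<b , b<hs with compare l b
  ...   | tri< l<b _ _ = b , l<b ∷ ls<b , b<hs
  ...   | tri≈ _ refl _ = above-all-below-all hs ls<b l<hs
  ...   | tri> _ _ b<l = above-all-below-all hs (All.map (λ x<b → trans x<b b<l) ls<b) l<hs

-- The image of encode need not be decidable; excluded middle provides the partial inverse.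
module Decoding (em : ExcludedMiddle 0ℓ) (D : CountableDLO) where
  open CountableDLO D

  decode : ℕ → Maybe Carrier
  decode n with em {∃[ x ] encode x ≡ n}
  ... | yes (x , _) = just x
  ... | no _        = nothing

  decode-encode : ∀ x → decode (encode x) ≡ just x
  decode-encode x with em {∃[ y ] encode y ≡ encode x}
  ... | yes (y , ey≡ex) = cong just (encode-injective ey≡ex)
  ... | no ∄y           = ⊥-elim (∄y (x , refl))

-- x is recorded as the number of outer 1+[2_] constructors, so pairᵇ is injective by matching.
pairᵇ : ℕ → ℕᵇ → ℕᵇ
pairᵇ zero    y = 2[1+ y ]
pairᵇ (suc x) y = 1+[2 pairᵇ x y ]

pairᵇ-injective : ∀ {x x' y y'} → pairᵇ x y ≡ pairᵇ x' y' → x ≡ x' × y ≡ y'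
pairᵇ-injective {zero}  {zero}   eq = refl , 2[1+_]-injective eq
pairᵇ-injective {suc x} {suc x'} eq =
  let x≡x' , y≡y' = pairᵇ-injective (1+[2_]-injective eq) in cong suc x≡x' , y≡y'

encodeℤ : ℤ → ℕᵇ
encodeℤ (+ n)    = 2[1+ ℕᵇ.fromℕ n ]
encodeℤ -[1+ n ] = 1+[2 ℕᵇ.fromℕ n ]

encodeℤ-injective : Injective _≡_ _≡_ encodeℤ
encodeℤ-injective {+ _}      {+ _}      eq = cong +_ (fromℕ-injective (2[1+_]-injective eq))
encodeℤ-injective { -[1+ _ ]} { -[1+ _ ]} eq = cong -[1+_] (fromℕ-injective (1+[2_]-injective eq))

encodeℚ : ℚ → ℕ
encodeℚ (mkℚ n d _) = ℕᵇ.toℕ (pairᵇ d (encodeℤ n))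

encodeℚ-injective : Injective _≡_ _≡_ encodeℚ
encodeℚ-injective {mkℚ n d _} {mkℚ n' d' _} eq with pairᵇ-injective {d} {d'} (ℕᵇ.toℕ-injective eq)
... | refl , en≡en' with encodeℤ-injective en≡en'
... | refl = refl

p<p+q : ∀ p {q} → ℚ.0ℚ ℚ.< q → p ℚ.< p ℚ.+ q
p<p+q p {q} 0<q = subst (ℚ._< p ℚ.+ q) (ℚ.+-identityʳ p) (ℚ.+-monoʳ-< p 0<q)

p+q<p : ∀ p {q} → q ℚ.< ℚ.0ℚ → p ℚ.+ q ℚ.< p
p+q<p p {q} q<0 = subst (p ℚ.+ q ℚ.<_) (ℚ.+-identityʳ p) (ℚ.+-monoʳ-< p q<0)

ℚ-countableDLO : CountableDLO
ℚ-countableDLO = record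
  { Carrier            = ℚ
  ; _<_                = ℚ._<_
  ; isDenseLinearOrder = ℚ.<-isDenseLinearOrder
  ; noMax              = λ p → p ℚ.+ ℚ.1ℚ , p<p+q p (ℚ.positive⁻¹ ℚ.1ℚ)
  ; noMin              = λ p → p ℚ.- ℚ.1ℚ , p+q<p p (ℚ.negative⁻¹ (ℚ.- ℚ.1ℚ))
  ; point              = ℚ.0ℚ
  ; encode             = encodeℚ
  ; encode-injective   = encodeℚ-injective
  }

module PartialIsomorphisms (A B : CountableDLO) where
  private
    module A = CountableDLO A
    module B = CountableDLO B

  Coherent : List (A.Carrier × B.Carrier) → Set
  Coherent L = ∀ {a b a' b'} → (a , b) ∈ L → (a' , b') ∈ L → a A.< a' ⇔ b B.< b'

  coherent-⊆ : ∀ {L M} → L ⊆ M → Coherent M → Coherent L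
  coherent-⊆ L⊆M coh p∈L q∈L = coh (L⊆M p∈L) (L⊆M q∈L)

  coherent-functional : ∀ {L a b b'} → Coherent L → (a , b) ∈ L → (a , b') ∈ L → b ≡ b'
  coherent-functional {b = b} {b'} coh p q with B.compare b b'
  ... | tri< b<b' _ _ = ⊥-elim (A.irrefl refl (Equivalence.from (coh p q) b<b'))
  ... | tri≈ _ b≡b' _ = b≡b'
  ... | tri> _ _ b'<b = ⊥-elim (A.irrefl refl (Equivalence.from (coh q p) b'<b))

  coherent-∷ : ∀ {L a b} → Coherent L →
               (∀ {a' b'} → (a' , b') ∈ L → (a A.< a' ⇔ b B.< b') × (a' A.< a ⇔ b' B.< b)) →
               Coherent ((a , b) ∷ L)
  coherent-∷ coh new (here refl) (here refl) = mk⇔ (⊥-elim ∘ A.irrefl refl) (⊥-elim ∘ B.irrefl refl)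
  coherent-∷ coh new (here refl) (there q)   = proj₁ (new q)
  coherent-∷ coh new (there p)   (here refl) = proj₂ (new p)
  coherent-∷ coh new (there p)   (there q)   = coh p q

  reflects-< : ∀ {a a' b b'} → a ≢ a' → (a' A.< a → b' B.< b) → b B.< b' → a A.< a'
  reflects-< {a} {a'} a≢a' pres b<b' with A.compare a a'
  ... | tri< a<a' _ _ = a<a'
  ... | tri≈ _ a≡a' _ = ⊥-elim (a≢a' a≡a')
  ... | tri> _ _ a'<a = ⊥-elim (B.asym b<b' (pres a'<a))

  images-below images-above : A.Carrier → List (A.Carrier × B.Carrier) → List B.Carrier
  images-below a L = map proj₂ (filter (λ p → proj₁ p A.<? a) L)
  images-above a L = map proj₂ (filter (λ p → a A.<? proj₁ p) L)

  module _ {a a' : A.Carrier} {b' : B.Carrier} {L : List (A.Carrier × B.Carrier)} where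
    ∈-images-below⁺ : (a' , b') ∈ L → a' A.< a → b' ∈ images-below a L
    ∈-images-below⁺ p∈L a'<a = ∈-map∘filter⁺ proj₂ (λ p → proj₁ p A.<? a) (_ , p∈L , refl , a'<a)

    ∈-images-above⁺ : (a' , b') ∈ L → a A.< a' → b' ∈ images-above a L
    ∈-images-above⁺ p∈L a<a' = ∈-map∘filter⁺ proj₂ (λ p → a A.<? proj₁ p) (_ , p∈L , refl , a<a')

  ∈-images-below⁻ : ∀ {a b' L} → b' ∈ images-below a L → ∃[ a' ] (a' , b') ∈ L × a' A.< a
  ∈-images-below⁻ {a} b'∈ with ∈-map∘filter⁻ proj₂ (λ p → proj₁ p A.<? a) b'∈
  ... | _ , p∈L , refl , a'<a = _ , p∈L , a'<a

  ∈-images-above⁻ : ∀ {a b' L} → b' ∈ images-above a L → ∃[ a' ] (a' , b') ∈ L × a A.< a'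
  ∈-images-above⁻ {a} b'∈ with ∈-map∘filter⁻ proj₂ (λ p → a A.<? proj₁ p) b'∈
  ... | _ , p∈L , refl , a<a' = _ , p∈L , a<a'

  open DecMembership A._≟_ using (_∈?_)

  extend : ∀ L → Coherent L → (a : A.Carrier) → ∃[ b ] Coherent ((a , b) ∷ L)
  extend L coh a with a ∈? map proj₁ L
  ... | yes a∈dom with ∈-map⁻ proj₁ a∈dom
  ...   | (_ , b) , ab∈L , refl = b , coherent-⊆ (∈-∷⁺ʳ ab∈L id) coh
  extend L coh a | no a∉dom = b , coherent-∷ coh new
    where
    separated : All (λ l → All (l B.<_) (images-above a L)) (images-below a L)
    separated = All.tabulate λ l∈ → All.tabulate λ h∈ →
      let _ , p∈L , a'<a = ∈-images-below⁻ l∈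
          _ , q∈L , a<a'' = ∈-images-above⁻ h∈
      in Equivalence.to (coh p∈L q∈L) (A.trans a'<a a<a'')
    interpolant = B.interpolate (images-below a L) (images-above a L) separated
    b = proj₁ interpolant
    new : ∀ {a' b'} → (a' , b') ∈ L → (a A.< a' ⇔ b B.< b') × (a' A.< a ⇔ b' B.< b)
    new {a'} {b'} p∈L = mk⇔ up (reflects-< a≢a' down) , mk⇔ down (reflects-< (a≢a' ∘ sym) up)
      where
      a≢a' : a ≢ a'
      a≢a' refl = a∉dom (∈-map⁺ proj₁ p∈L)
      down : a' A.< a → b' B.< b
      down a'<a = All.lookup (proj₁ (proj₂ interpolant)) (∈-images-below⁺ p∈L a'<a)
      up : a A.< a' → b B.< b'
      up a<a' = All.lookup (proj₂ (proj₂ interpolant)) (∈-images-above⁺ p∈L a<a')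

module BackAndForth (em : ExcludedMiddle 0ℓ) (A B : CountableDLO) where
  private
    module A = CountableDLO A
    module B = CountableDLO B
    module AB = PartialIsomorphisms A B
    module BA = PartialIsomorphisms B A
    module DA = Decoding em A
    module DB = Decoding em B

  PartialIso : Set
  PartialIso = Σ (List (A.Carrier × B.Carrier)) AB.Coherent

  pairs : PartialIso → List (A.Carrier × B.Carrier)
  pairs = proj₁

  coherent-swap : ∀ {L} → AB.Coherent L → BA.Coherent (map swap L)
  coherent-swap {L} coh p q with ∈-map⁻ swap p | ∈-map⁻ swap q
  ... | _ , p∈L , refl | _ , q∈L , refl = ⇔.sym (coh p∈L q∈L)

  swap-coherent : ∀ {L} → BA.Coherent (map swap L) → AB.Coherent L
  swap-coherent coh p q = ⇔.sym (coh (∈-map⁺ swap p) (∈-map⁺ swap q))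

  forth : Maybe A.Carrier → PartialIso → PartialIso
  forth nothing  P         = P
  forth (just a) (L , coh) = let b , coh' = AB.extend L coh a in (a , b) ∷ L , coh'

  back : Maybe B.Carrier → PartialIso → PartialIso
  back nothing  P         = P
  back (just b) (L , coh) =
    let a , coh' = BA.extend (map swap L) (coherent-swap coh) b in (a , b) ∷ L , swap-coherent coh'

  forth-⊆ : ∀ x P → pairs P ⊆ pairs (forth x P)
  forth-⊆ nothing  P = id
  forth-⊆ (just _) P = there

  back-⊆ : ∀ y P → pairs P ⊆ pairs (back y P)
  back-⊆ nothing  P = id
  back-⊆ (just _) P = there

  -- Stage n+1 adds the point of A with code n to the domain and the point of B with code n to the range.
  stage : ℕ → PartialIso
  stage zero    = [] , λ ()
  stage (suc n) = back (DB.decode n) (forth (DA.decode n) (stage n))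

  stage-mono : ∀ {m n} → m ≤′ n → pairs (stage m) ⊆ pairs (stage n)
  stage-mono ℕ.≤′-refl            = id
  stage-mono (ℕ.≤′-step {n} m≤′n) =
    back-⊆ (DB.decode n) (forth (DA.decode n) (stage n))
    ∘ forth-⊆ (DA.decode n) (stage n)
    ∘ stage-mono m≤′n

  stage-⊔ˡ : ∀ m n → pairs (stage m) ⊆ pairs (stage (m ⊔ n))
  stage-⊔ˡ m n = stage-mono (≤⇒≤′ (m≤m⊔n m n))

  stage-⊔ʳ : ∀ m n → pairs (stage n) ⊆ pairs (stage (m ⊔ n))
  stage-⊔ʳ m n = stage-mono (≤⇒≤′ (m≤n⊔m m n))

  in-domain : ∀ a → ∃[ b ] (a , b) ∈ pairs (stage (suc (A.encode a)))
  in-domain a rewrite DA.decode-encode a =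
    _ , back-⊆ (DB.decode (A.encode a)) (forth (just a) (stage (A.encode a))) (here refl)

  in-range : ∀ b → ∃[ a ] (a , b) ∈ pairs (stage (suc (B.encode b)))
  in-range b rewrite DB.decode-encode b = _ , here refl

  iso : A.Carrier → B.Carrier
  iso a = proj₁ (in-domain a)

  iso-⇔ : ∀ a a' → a A.< a' ⇔ iso a B.< iso a'
  iso-⇔ a a' =
    let m = suc (A.encode a); n = suc (A.encode a')
    in proj₂ (stage (m ⊔ n)) (stage-⊔ˡ m n (proj₂ (in-domain a)))
                             (stage-⊔ʳ m n (proj₂ (in-domain a')))

  iso-surjective : StrictlySurjective _≡_ iso
  iso-surjective b =
    let a , ab∈ = in-range b
        m = suc (A.encode a); n = suc (B.encode b)
    in a , AB.coherent-functional (proj₂ (stage (m ⊔ n)))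
                                  (stage-⊔ˡ m n (proj₂ (in-domain a))) (stage-⊔ʳ m n ab∈)

  cantor : ∃ (IsOrderIsomorphism _≡_ _≡_ A._<_ B._<_)
  cantor = iso , isOrderIsomorphism A.isStrictTotalOrder iso-⇔ iso-surjective

_≟ᶜ_ : DecidableEquality Colour
red  ≟ᶜ red  = yes refl
red  ≟ᶜ blue = no λ ()
blue ≟ᶜ red  = no λ ()
blue ≟ᶜ blue = yes refl

other-≢ : ∀ c → other c ≢ c
other-≢ red  ()
other-≢ blue ()

≢⇒≡other : ∀ {c d} → c ≢ d → d ≡ other c
≢⇒≡other {red}  {red}  c≢d = ⊥-elim (c≢d refl)
≢⇒≡other {red}  {blue} _   = refl
≢⇒≡other {blue} {red}  _   = refl
≢⇒≡other {blue} {blue} c≢d = ⊥-elim (c≢d refl)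

≡other⇒≢ : ∀ {c d} → d ≡ other c → c ≢ d
≡other⇒≢ {c} d≡oc c≡d = other-≢ c (≡.trans (sym d≡oc) (sym c≡d))

≢-≢⇒≡ : ∀ {c d e} → c ≢ d → e ≢ c → e ≡ d
≢-≢⇒≡ c≢d e≢c = ≡.trans (≢⇒≡other (e≢c ∘ sym)) (sym (≢⇒≡other c≢d))

module _ {A B : ColOrd} where
  private
    module A = ColOrd A
    module B = ColOrd B

  toColIso : ∀ {f} → IsOrderIsomorphism _≡_ _≡_ A._≺_ B._≺_ f →
             (∀ x → B.colour (f x) ≡ A.colour x) → A ≅ B
  toColIso {f} isIso pres-col = record
    { f         = f
    ; bijective = injective , surjective
    ; pres-≺    = λ x y → mk⇔ mono cancel
    ; pres-col  = pres-col
    } where open IsOrderIsomorphism isIso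

≅-trans : ∀ {A B C} → A ≅ B → B ≅ C → A ≅ C
≅-trans A≅B B≅C = record
  { f         = g.f ∘ f.f
  ; bijective = Compose.bijective _≡_ _≡_ _≡_ f.bijective g.bijective
  ; pres-≺    = λ x y → ⇔.trans (f.pres-≺ x y) (g.pres-≺ (f.f x) (f.f y))
  ; pres-col  = λ x → ≡.trans (g.pres-col (f.f x)) (f.pres-col x)
  }
  where
  module f = ColIso A≅B
  module g = ColIso B≅C

Single⊕Single≅Double : ∀ c → (Single c ⊕ Single (other c)) ≅ Double c
Single⊕Single≅Double c = record
  { f         = λ { (inj₁ zero) → zero ; (inj₂ zero) → suc zero }
  ; bijective = (λ { {inj₁ zero} {inj₁ zero} _ → refl ; {inj₁ zero} {inj₂ zero} ()
                  ; {inj₂ zero} {inj₁ zero} () ; {inj₂ zero} {inj₂ zero} _ → refl })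
              , (λ { zero → inj₁ zero , λ { refl → refl } ; (suc zero) → inj₂ zero , λ { refl → refl } })
  ; pres-≺    = λ { (inj₁ zero) (inj₁ zero) → mk⇔ (λ ()) (λ ())
                  ; (inj₁ zero) (inj₂ zero) → mk⇔ (λ _ → ℕ.s≤s ℕ.z≤n) (λ _ → tt)
                  ; (inj₂ zero) (inj₁ zero) → mk⇔ (λ ()) (λ ())
                  ; (inj₂ zero) (inj₂ zero) → mk⇔ (λ ()) (λ { (ℕ.s≤s ()) }) }
  ; pres-col  = λ { (inj₁ zero) → refl ; (inj₂ zero) → refl }
  }

_⊕-cong_ : ∀ {A A' B B'} → A ≅ A' → B ≅ B' → (A ⊕ B) ≅ (A' ⊕ B')
A≅A' ⊕-cong B≅B' = record
  { f         = Sum.map f.f g.f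
  ; bijective = Bijection.bijective (mk⤖ f.bijective ⊎-⤖ mk⤖ g.bijective)
  ; pres-≺    = λ { (inj₁ x) (inj₁ y) → f.pres-≺ x y ; (inj₁ _) (inj₂ _) → ⇔.refl
                  ; (inj₂ _) (inj₁ _) → ⇔.refl ; (inj₂ x) (inj₂ y) → g.pres-≺ x y }
  ; pres-col  = λ { (inj₁ x) → f.pres-col x ; (inj₂ y) → g.pres-col y }
  }
  where
  module f = ColIso A≅A'
  module g = ColIso B≅B'

module Classes (G : OrderedBipartiteGraph) where
  open OrderedBipartiteGraph G public
  open IsStrictTotalOrder isStrictTotalOrder public using (compare; irrefl; asym) renaming (trans to <-trans)

  Class : Colour → Set
  Class c = Σ[ x ∈ X ] colour x ≡ c

  ClassOrd : Colour → ColOrd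
  ClassOrd c = record { Carrier = Class c ; _≺_ = λ u v → proj₁ u < proj₁ v ; colour = colour ∘ proj₁ }

  class-≡ : ∀ {c} {u v : Class c} → proj₁ u ≡ proj₁ v → u ≡ v
  class-≡ {u = x , e} {.x , e'} refl = cong (x ,_) (Decidable⇒UIP.≡-irrelevant _≟ᶜ_ e e')

  class-compare : ∀ {c} → Trichotomous _≡_ (ColOrd._≺_ (ClassOrd c))
  class-compare u v with compare (proj₁ u) (proj₁ v)
  ... | tri< u<v u≢v v≮u = tri< u<v (u≢v ∘ cong proj₁) v≮u
  ... | tri≈ u≮v u≡v v≮u = tri≈ u≮v (class-≡ u≡v) v≮u
  ... | tri> u≮v u≢v v<u = tri> u≮v (u≢v ∘ cong proj₁) v<u

  class-isStrictTotalOrder : ∀ c → IsStrictTotalOrder _≡_ (ColOrd._≺_ (ClassOrd c))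
  class-isStrictTotalOrder c = isStrictTotalOrderᶜ record
    { isEquivalence = ≡.isEquivalence ; trans = <-trans ; compare = class-compare }

  colOrd≅ : ∀ {A f} → (∀ x y → x < y ⇔ ColOrd._≺_ A (f x) (f y)) → StrictlySurjective _≡_ f →
            (∀ x → ColOrd.colour A (f x) ≡ colour x) → colOrd ≅ A
  colOrd≅ pres surjective = toColIso (isOrderIsomorphism isStrictTotalOrder pres surjective)

  HasTwoPoints : Colour → Set
  HasTwoPoints c = ∃[ x ] ∃[ y ] x < y × colour x ≡ c × colour y ≡ c

  at-most-one : ∀ {c x y} → ¬ HasTwoPoints c → colour x ≡ c → colour y ≡ c → x ≡ y
  at-most-one {x = x} {y} ¬two cx cy with compare x y
  ... | tri< x<y _ _ = ⊥-elim (¬two (x , y , x<y , cx , cy))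
  ... | tri≈ _ x≡y _ = x≡y
  ... | tri> _ _ y<x = ⊥-elim (¬two (y , x , y<x , cy , cx))

  AllBelow : Colour → Colour → Set
  AllBelow c d = ∀ {x y} → colour x ≡ c → colour y ≡ d → x < y

  ClassOrd≅Single : ∀ {c x} → colour x ≡ c → ¬ HasTwoPoints c → ClassOrd c ≅ Single c
  ClassOrd≅Single {c} {x} cx ¬two = toColIso
    (isOrderIsomorphism (class-isStrictTotalOrder c)
      (λ (y , cy) (z , cz) → mk⇔ (λ y<z → ⊥-elim (irrefl (at-most-one ¬two cy cz) y<z)) (λ ()))
      (λ { zero → (x , cx) , refl }))
    (sym ∘ proj₂)

  colOrd≅ClassOrd : ∀ {c} → (∀ x → colour x ≡ c) → colOrd ≅ ClassOrd c
  colOrd≅ClassOrd all-c =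
    colOrd≅ {f = λ x → x , all-c x} (λ x y → ⇔.refl) (λ (x , _) → x , class-≡ refl) (λ _ → refl)

  module _ {c d} (c≢d : c ≢ d) (c<d : AllBelow c d) where
    private
      sort : ∀ x → Dec (colour x ≡ c) → Class c ⊎ Class d
      sort x (yes cx) = inj₁ (x , cx)
      sort x (no ¬cx) = inj₂ (x , ≢-≢⇒≡ c≢d ¬cx)

      sort-pres : ∀ x y dx dy → x < y ⇔ ColOrd._≺_ (ClassOrd c ⊕ ClassOrd d) (sort x dx) (sort y dy)
      sort-pres x y (yes _)  (yes _)  = ⇔.refl
      sort-pres x y (yes cx) (no ¬cy) = mk⇔ _ (λ _ → c<d cx (≢-≢⇒≡ c≢d ¬cy))
      sort-pres x y (no ¬cx) (yes cy) = mk⇔ (λ x<y → asym x<y (c<d cy (≢-≢⇒≡ c≢d ¬cx))) λ ()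
      sort-pres x y (no _)   (no _)   = ⇔.refl

      sort-inj₁ : ∀ {x} (cx : colour x ≡ c) dx → sort x dx ≡ inj₁ (x , cx)
      sort-inj₁ cx (yes _)  = cong inj₁ (class-≡ refl)
      sort-inj₁ cx (no ¬cx) = ⊥-elim (¬cx cx)

      sort-inj₂ : ∀ {x} (dx : colour x ≡ d) cx? → sort x cx? ≡ inj₂ (x , dx)
      sort-inj₂ dx (yes cx) = ⊥-elim (c≢d (≡.trans (sym cx) dx))
      sort-inj₂ dx (no _)   = cong inj₂ (class-≡ refl)

      sort-colour : ∀ x dx → ColOrd.colour (ClassOrd c ⊕ ClassOrd d) (sort x dx) ≡ colour x
      sort-colour x (yes _) = refl
      sort-colour x (no _)  = refl

    colOrd≅ClassOrd⊕ClassOrd : colOrd ≅ (ClassOrd c ⊕ ClassOrd d)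
    colOrd≅ClassOrd⊕ClassOrd = colOrd≅ {f = λ x → sort x (colour x ≟ᶜ c)}
      (λ x y → sort-pres x y (colour x ≟ᶜ c) (colour y ≟ᶜ c))
      (λ { (inj₁ (x , cx)) → x , sort-inj₁ cx (colour x ≟ᶜ c)
         ; (inj₂ (x , dx)) → x , sort-inj₂ dx (colour x ≟ᶜ c) })
      (λ x → sort-colour x (colour x ≟ᶜ c))

  _⋖_ : Rel X 0ℓ
  x ⋖ y = x < y × ¬ (∃[ z ] x < z × z < y)

  ⋖-next : ∀ {p s z} → p ⋖ s → p < z → z ≢ s → s < z
  ⋖-next {s = s} {z} (_ , empty) p<z z≢s with compare z s
  ... | tri< z<s _ _ = ⊥-elim (empty (z , p<z , z<s))
  ... | tri≈ _ z≡s _ = ⊥-elim (z≢s z≡s)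
  ... | tri> _ _ s<z = s<z

  ⋖-prev : ∀ {p s z} → p ⋖ s → z < s → z ≢ p → z < p
  ⋖-prev {p} {z = z} (_ , empty) z<s z≢p with compare z p
  ... | tri< z<p _ _ = z<p
  ... | tri≈ _ z≡p _ = ⊥-elim (z≢p z≡p)
  ... | tri> _ _ p<z = ⊥-elim (empty (z , p<z , z<s))

  ⋖-functionalʳ : ∀ {p s s'} → p ⋖ s → p ⋖ s' → s ≡ s'
  ⋖-functionalʳ {s = s} {s'} p⋖s p⋖s' with compare s s'
  ... | tri< s<s' _ _ = ⊥-elim (proj₂ p⋖s' (s , proj₁ p⋖s , s<s'))
  ... | tri≈ _ s≡s' _ = s≡s'
  ... | tri> _ _ s'<s = ⊥-elim (proj₂ p⋖s (s' , proj₁ p⋖s' , s'<s))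

  ⋖-functionalˡ : ∀ {p p' s} → p ⋖ s → p' ⋖ s → p ≡ p'
  ⋖-functionalˡ {p} {p'} p⋖s p'⋖s with compare p p'
  ... | tri< p<p' _ _ = ⊥-elim (proj₂ p⋖s (p' , p<p' , proj₁ p'⋖s))
  ... | tri≈ _ p≡p' _ = p≡p'
  ... | tri> _ _ p'<p = ⊥-elim (proj₂ p'⋖s (p , p'<p , proj₁ p⋖s))

  SomeBelow : Colour → Colour → Set
  SomeBelow c d = ∃[ x ] ∃[ y ] x < y × colour x ≡ c × colour y ≡ d

  ¬SomeBelow⇒AllBelow : ∀ {c d} → c ≢ d → ¬ SomeBelow d c → AllBelow c d
  ¬SomeBelow⇒AllBelow c≢d ¬below {x} {y} cx dy with compare x y
  ... | tri< x<y _ _ = x<y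
  ... | tri≈ _ refl _ = ⊥-elim (c≢d (≡.trans (sym cx) dy))
  ... | tri> _ _ y<x = ⊥-elim (¬below (y , x , y<x , dy , cx))

module Homogeneity (G : OrderedBipartiteGraph) (homogeneous : OrderedBipartiteGraph.Homogeneous G) where
  open Classes G
  open Automorphism

  σ-mono : ∀ s {x y} → x < y → σ s x < σ s y
  σ-mono s {x} {y} = Equivalence.to (pres-< s x y)

  σ-cancel : ∀ s {x y} → σ s x < σ s y → x < y
  σ-cancel s {x} {y} = Equivalence.from (pres-< s x y)

  σ-onto : ∀ s → StrictlySurjective _≡_ (σ s)
  σ-onto s = surjective⇒strictlySurjective (proj₂ (bijective s))

  same-comparisons-≡ : ∀ {x y x' y'} → x < y ⇔ x' < y' → y < x ⇔ y' < x' → x ≡ y → x' ≡ y'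
  same-comparisons-≡ {x' = x'} {y'} xy yx refl with compare x' y'
  ... | tri< x'<y' _ _ = ⊥-elim (irrefl refl (Equivalence.from xy x'<y'))
  ... | tri≈ _ x'≡y' _ = x'≡y'
  ... | tri> _ _ y'<x' = ⊥-elim (irrefl refl (Equivalence.from yx y'<x'))

  monochromatic-isFinitePartialIso : ∀ {n c} (a b : Fin n → X) →
                                     (∀ i → colour (a i) ≡ c) → (∀ i → colour (b i) ≡ c) →
                                     (∀ i j → a i < a j ⇔ b i < b j) → IsFinitePartialIso a b
  monochromatic-isFinitePartialIso {n} {c} a b ca cb pres =
      (λ i j → mk⇔ (same-comparisons-≡ (pres i j) (pres j i))
                   (same-comparisons-≡ (⇔.sym (pres i j)) (⇔.sym (pres j i))))
    , pres
    , (λ i j → mk⇔ (⊥-elim ∘ no-edge ca i j) (⊥-elim ∘ no-edge cb i j))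
    , (λ i → ≡.trans (cb i) (sym (ca i)))
    where
    no-edge : ∀ {v : Fin n → X} → (∀ i → colour (v i) ≡ c) → ∀ i j → ¬ R (v i) (v j)
    no-edge cv i j r = R-bipartite r (≡.trans (cv i) (sym (cv j)))

  move : ∀ {x y} → colour x ≡ colour y → ∃[ s ] σ s x ≡ y
  move {x} {y} cx≡cy =
    let s , sx≡y = homogeneous 1 (λ _ → x) (λ _ → y)
                     (monochromatic-isFinitePartialIso _ _ (λ _ → refl) (λ _ → sym cx≡cy) never)
    in s , sx≡y zero
    where
    never : ∀ i j → x < x ⇔ y < y
    never _ _ = mk⇔ (⊥-elim ∘ irrefl refl) (⊥-elim ∘ irrefl refl)

  pair : X → X → Fin 2 → X
  pair x x' zero    = x
  pair x x' (suc _) = x'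

  move₂ : ∀ {c x x' y y'} → colour x ≡ c → colour x' ≡ c → colour y ≡ c → colour y' ≡ c →
          x < x' → y < y' → ∃[ s ] σ s x ≡ y × σ s x' ≡ y'
  move₂ {c} {x} {x'} {y} {y'} cx cx' cy cy' x<x' y<y' =
    let s , sx≡y = homogeneous 2 (pair x x') (pair y y') (monochromatic-isFinitePartialIso _ _ cxs cys pres)
    in s , sx≡y zero , sx≡y (suc zero)
    where
    cxs : ∀ i → colour ((pair x x') i) ≡ c
    cxs zero       = cx
    cxs (suc _)    = cx'
    cys : ∀ i → colour ((pair y y') i) ≡ c
    cys zero       = cy
    cys (suc _)    = cy'
    pres : ∀ i j → (pair x x') i < (pair x x') j ⇔ (pair y y') i < (pair y y') j
    pres zero    zero    = mk⇔ (⊥-elim ∘ irrefl refl) (⊥-elim ∘ irrefl refl)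
    pres zero    (suc _) = mk⇔ (λ _ → y<y') (λ _ → x<x')
    pres (suc _) zero    = mk⇔ (⊥-elim ∘ asym x<x') (⊥-elim ∘ asym y<y')
    pres (suc _) (suc _) = mk⇔ (⊥-elim ∘ irrefl refl) (⊥-elim ∘ irrefl refl)

  transport-below : ∀ {u w w'} → colour w ≡ colour w' → u < w → ∃[ u' ] u' < w' × colour u' ≡ colour u
  transport-below {u} cw≡cw' u<w =
    let s , sw≡w' = move cw≡cw' in σ s u , subst (σ s u <_) sw≡w' (σ-mono s u<w) , pres-col s u

  transport-above : ∀ {u w w'} → colour w ≡ colour w' → w < u → ∃[ u' ] w' < u' × colour u' ≡ colour u
  transport-above {u} cw≡cw' w<u =
    let s , sw≡w' = move cw≡cw' in σ s u , subst (_< σ s u) sw≡w' (σ-mono s w<u) , pres-col s u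

  Pattern : Colour → Colour → Set
  Pattern c d = ∃[ u ] ∃[ w ] ∃[ v ] u < w × w < v × colour u ≡ c × colour w ≡ d × colour v ≡ c

  fill : ∀ {c d x y} → Pattern c d → colour x ≡ c → colour y ≡ c → x < y → ∃[ z ] x < z × z < y × colour z ≡ d
  fill (u , w , v , u<w , w<v , cu , dw , cv) cx cy x<y =
    let s , su≡x , sv≡y = move₂ cu cv cx cy (<-trans u<w w<v) x<y
    in σ s w , subst (_< σ s w) su≡x (σ-mono s u<w) , subst (σ s w <_) sv≡y (σ-mono s w<v)
             , ≡.trans (pres-col s w) dw

  class-noMax : ∀ {c x} → HasTwoPoints c → colour x ≡ c → ∃[ y ] x < y × colour y ≡ c
  class-noMax (u , v , u<v , cu , cv) cx =
    let y , x<y , cy = transport-above (≡.trans cu (sym cx)) u<v in y , x<y , ≡.trans cy cv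

  class-noMin : ∀ {c x} → HasTwoPoints c → colour x ≡ c → ∃[ y ] y < x × colour y ≡ c
  class-noMin (u , v , u<v , cu , cv) cx =
    let y , y<x , cy = transport-below (≡.trans cv (sym cx)) u<v in y , y<x , ≡.trans cy cu

  monochromatic-pattern : ∀ {c} → HasTwoPoints c → Pattern c c
  monochromatic-pattern two@(u , v , u<v , cu , cv) =
    let w , v<w , cw = class-noMax two cv in u , v , w , u<v , v<w , cu , cv , cw

  interleaved-pattern : ∀ {c d} → SomeBelow c d → SomeBelow d c → Pattern c d
  interleaved-pattern (x , y , x<y , cx , dy) (y' , x' , y'<x' , dy' , cx') =
    let x'' , x''<y' , cx'' = transport-below (≡.trans dy (sym dy')) x<y
    in x'' , y' , x' , x''<y' , y'<x' , ≡.trans cx'' cx , dy' , cx'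

  -- An automorphism moving z to x fixes b, the only point of its colour.
  below-lonely : ∀ {b x z} → ¬ HasTwoPoints (colour b) → colour z ≡ colour x → x < b → z < b
  below-lonely {b} {x} {z} lonely cz≡cx x<b with compare z b
  ... | tri< z<b _ _ = z<b
  ... | tri≈ _ refl _ = ⊥-elim (lonely (x , b , x<b , sym cz≡cx , refl))
  ... | tri> _ _ b<z =
    let s , sz≡x = move cz≡cx
        sb≡b = at-most-one lonely (pres-col s b) refl
    in ⊥-elim (asym x<b (subst₂ _<_ sb≡b sz≡x (σ-mono s b<z)))

  σ-⋖ : ∀ s {x y} → x ⋖ y → σ s x ⋖ σ s y
  σ-⋖ s {x} {y} (x<y , empty) = σ-mono s x<y , λ (z , sx<z , z<sy) →
    let w , sw≡z = σ-onto s z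
    in empty (w , σ-cancel s (subst (σ s x <_) (sym sw≡z) sx<z)
                , σ-cancel s (subst (_< σ s y) (sym sw≡z) z<sy))

  transport-⋖ʳ : ∀ {x y x'} → x ⋖ y → colour x ≡ colour x' → ∃[ y' ] x' ⋖ y' × colour y' ≡ colour y
  transport-⋖ʳ {y = y} x⋖y cx≡cx' =
    let s , sx≡x' = move cx≡cx' in σ s y , subst (_⋖ σ s y) sx≡x' (σ-⋖ s x⋖y) , pres-col s y

  transport-⋖ˡ : ∀ {x y y'} → x ⋖ y → colour y ≡ colour y' → ∃[ x' ] x' ⋖ y' × colour x' ≡ colour x
  transport-⋖ˡ {x} x⋖y cy≡cy' =
    let s , sy≡y' = move cy≡cy' in σ s x , subst (σ s x ⋖_) sy≡y' (σ-⋖ s x⋖y) , pres-col s x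

module Classification (em : ExcludedMiddle 0ℓ) (G : OrderedBipartiteGraph)
                      (countable : OrderedBipartiteGraph.Countable G)
                      (homogeneous : OrderedBipartiteGraph.Homogeneous G) where
  open Classes G public
  open Homogeneity G homogeneous
  open IsStrictTotalOrder isStrictTotalOrder using (_≟_)

  class-countableDLO : ∀ {c} → HasTwoPoints c → CountableDLO
  class-countableDLO {c} two = record
    { Carrier            = Class c
    ; _<_                = ColOrd._≺_ (ClassOrd c)
    ; isDenseLinearOrder = record
      { isStrictTotalOrder = class-isStrictTotalOrder c
      ; dense              = λ {(x , cx)} {(y , cy)} x<y →
          let z , x<z , z<y , cz = fill (monochromatic-pattern two) cx cy x<y in (z , cz) , x<z , z<y
      }
    ; noMax            = λ (x , cx) → let y , x<y , cy = class-noMax two cx in (y , cy) , x<y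
    ; noMin            = λ (x , cx) → let y , y<x , cy = class-noMin two cx in (y , cy) , y<x
    ; point            = proj₁ two , proj₁ (proj₂ (proj₂ (proj₂ two)))
    ; encode           = proj₁ countable ∘ proj₁
    ; encode-injective = class-≡ ∘ proj₂ countable
    }

  ClassOrd≅QMono : ∀ {c} → HasTwoPoints c → ClassOrd c ≅ QMono c
  ClassOrd≅QMono two =
    toColIso (proj₂ (BackAndForth.cantor em (class-countableDLO two) ℚ-countableDLO)) (sym ∘ proj₂)

  all-of-colour : ∀ {c} → ¬ (∃[ y ] colour y ≡ other c) → ∀ x → colour x ≡ c
  all-of-colour {c} ∄y x with colour x ≟ᶜ c
  ... | yes cx  = cx
  ... | no ¬cx = ⊥-elim (∄y (x , ≢⇒≡other (¬cx ∘ sym)))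

  colOrd≅Double : (∀ c → ¬ HasTwoPoints c) → ∀ {x y} → x < y → colour x ≢ colour y →
                  colOrd ≅ Double (colour x)
  colOrd≅Double lonely {x} {y} x<y cx≢cy =
    ≅-trans (colOrd≅ClassOrd⊕ClassOrd (other-≢ _ ∘ sym) x-below-y)
      (≅-trans (ClassOrd≅Single refl (lonely _) ⊕-cong ClassOrd≅Single cy (lonely _)) (Single⊕Single≅Double _))
    where
    cy : colour y ≡ other (colour x)
    cy = ≢⇒≡other cx≢cy
    x-below-y : AllBelow (colour x) (other (colour x))
    x-below-y cz cw = subst₂ _<_ (sym (at-most-one (lonely _) cz refl)) (sym (at-most-one (lonely _) cw cy)) x<y

  case-i : (∀ c → ¬ HasTwoPoints c) → X → OneOfTheListedOrders colOrd
  case-i lonely x₀ with em {∃[ y ] colour y ≡ other (colour x₀)}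
  ... | no ∄y = inj₁ (colour x₀ ,
        ≅-trans (colOrd≅ClassOrd (all-of-colour ∄y)) (ClassOrd≅Single refl (lonely _)))
  ... | yes (y , cy) with compare x₀ y
  ...   | tri< x₀<y _ _ = inj₂ (inj₁ (colour x₀ , colOrd≅Double lonely x₀<y (≡other⇒≢ cy)))
  ...   | tri≈ _ refl _ = ⊥-elim (other-≢ _ (sym cy))
  ...   | tri> _ _ y<x₀ = inj₂ (inj₁ (colour y , colOrd≅Double lonely y<x₀ (≡other⇒≢ cy ∘ sym)))

  case-ii-iii : ∀ {c} → HasTwoPoints c → ¬ HasTwoPoints (other c) → OneOfTheListedOrders colOrd
  case-ii-iii {c} two lonely with em {∃[ b ] colour b ≡ other c}
  ... | no ∄b = inj₂ (inj₂ (inj₁ (c ,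
        ≅-trans (colOrd≅ClassOrd (all-of-colour ∄b)) (ClassOrd≅QMono two))))
  ... | yes (b , cb) with em {∃[ x ] x < b × colour x ≡ c}
  ...   | yes (x , x<b , cx) = inj₂ (inj₂ (inj₂ (inj₁ (c ,
          ≅-trans (colOrd≅ClassOrd⊕ClassOrd (other-≢ c ∘ sym) c-below-b)
                  (ClassOrd≅QMono two ⊕-cong ClassOrd≅Single cb lonely)))))
    where
    c-below-b : AllBelow c (other c)
    c-below-b cz cw = subst (_ <_) (sym (at-most-one lonely cw cb))
      (below-lonely (subst (¬_ ∘ HasTwoPoints) (sym cb) lonely) (≡.trans cz (sym cx)) x<b)
  ...   | no ∄x = inj₂ (inj₂ (inj₂ (inj₂ (inj₁ (c ,
          ≅-trans (colOrd≅ClassOrd⊕ClassOrd (other-≢ c) b-below-c)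
                  (ClassOrd≅Single cb lonely ⊕-cong ClassOrd≅QMono two))))))
    where
    b-below-c : AllBelow (other c) c
    b-below-c = ¬SomeBelow⇒AllBelow (other-≢ c) λ (z , w , z<w , cz , cw) →
      ∄x (z , subst (z <_) (at-most-one lonely cw cb) z<w , cz)

  module CoveringPairs {c} (two : HasTwoPoints c) {x₀ y₀} (x₀⋖y₀ : x₀ ⋖ y₀) (cx₀ : colour x₀ ≡ c) where
    private
      module g = ColIso (ClassOrd≅QMono two)

    cy₀ : colour y₀ ≡ other c
    cy₀ = ≢⇒≡other λ c≡cy₀ →
      let z , x₀<z , z<y₀ , _ = fill (monochromatic-pattern two) cx₀ (sym c≡cy₀) (proj₁ x₀⋖y₀)
      in proj₂ x₀⋖y₀ (z , x₀<z , z<y₀)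

    predecessor : ∀ {x} → colour x ≢ c → Σ[ p ∈ Class c ] proj₁ p ⋖ x
    predecessor ¬cx = let p , p⋖x , cp = transport-⋖ˡ x₀⋖y₀ (≡.trans cy₀ (sym (≢⇒≡other (¬cx ∘ sym))))
                      in (p , ≡.trans cp cx₀) , p⋖x

    ≢-by-colour : ∀ {x y} → colour x ≡ c → colour y ≢ c → x ≢ y
    ≢-by-colour cx ¬cy refl = ¬cy cx

    -- X is ClassOrd c × 2 ordered lexicographically: a point x of colour c sits at (x , 0)
    -- and the point covering it at (x , 1).
    position : ∀ x → Dec (colour x ≡ c) → ℚ × Fin 2
    position x (yes cx) = g.f (x , cx) , zero
    position x (no ¬cx) = g.f (proj₁ (predecessor ¬cx)) , suc zero

    g-mono : ∀ {u v} → proj₁ u < proj₁ v → g.f u ℚ.< g.f v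
    g-mono {u} {v} = Equivalence.to (g.pres-≺ u v)

    g-cancel : ∀ {u v} → g.f u ℚ.< g.f v → proj₁ u < proj₁ v
    g-cancel {u} {v} = Equivalence.from (g.pres-≺ u v)

    _≺₂_ : Rel (ℚ × Fin 2) 0ℓ
    _≺₂_ = ColOrd._≺_ (QTwo c)

    position-pres : ∀ x y dx dy → x < y ⇔ position x dx ≺₂ position y dy
    position-pres x y (yes cx) (yes cy) = mk⇔ (inj₁ ∘ g-mono) λ { (inj₁ lt) → g-cancel lt ; (inj₂ (_ , ())) }
    position-pres x y (yes cx) (no ¬cy) = mk⇔ (λ x<y → to x<y (x ≟ proj₁ q)) from
      where
      q = proj₁ (predecessor ¬cy)
      q⋖y = proj₂ (predecessor ¬cy)
      to : x < y → Dec (x ≡ proj₁ q) → position x (yes cx) ≺₂ position y (no ¬cy)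
      to x<y (yes x≡q) = inj₂ (cong g.f (class-≡ x≡q) , ℕ.s≤s ℕ.z≤n)
      to x<y (no x≢q)  = inj₁ (g-mono (⋖-prev q⋖y x<y x≢q))
      from : position x (yes cx) ≺₂ position y (no ¬cy) → x < y
      from (inj₁ lt)       = <-trans (g-cancel lt) (proj₁ q⋖y)
      from (inj₂ (eq , _)) = subst (_< y) (sym (cong proj₁ (proj₁ g.bijective eq))) (proj₁ q⋖y)
    position-pres x y (no ¬cx) (yes cy) = mk⇔ to from
      where
      p = proj₁ (predecessor ¬cx)
      p⋖x = proj₂ (predecessor ¬cx)
      to : x < y → position x (no ¬cx) ≺₂ position y (yes cy)
      to x<y = inj₁ (g-mono (<-trans (proj₁ p⋖x) x<y))
      from : position x (no ¬cx) ≺₂ position y (yes cy) → x < y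
      from (inj₁ lt) = ⋖-next p⋖x (g-cancel lt) (≢-by-colour cy ¬cx)
      from (inj₂ (_ , ()))
    position-pres x y (no ¬cx) (no ¬cy) = mk⇔ (λ x<y → to x<y (proj₁ p ≟ proj₁ q)) from
      where
      p = proj₁ (predecessor ¬cx)
      p⋖x = proj₂ (predecessor ¬cx)
      q = proj₁ (predecessor ¬cy)
      q⋖y = proj₂ (predecessor ¬cy)
      to : x < y → Dec (proj₁ p ≡ proj₁ q) → position x (no ¬cx) ≺₂ position y (no ¬cy)
      to x<y (yes p≡q) = ⊥-elim (irrefl (⋖-functionalʳ p⋖x (subst (_⋖ y) (sym p≡q) q⋖y)) x<y)
      to x<y (no p≢q)  = inj₁ (g-mono (⋖-prev q⋖y (<-trans (proj₁ p⋖x) x<y) p≢q))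
      from : position x (no ¬cx) ≺₂ position y (no ¬cy) → x < y
      from (inj₁ lt) = <-trans (⋖-next p⋖x (g-cancel lt) (≢-by-colour (proj₂ q) ¬cx)) (proj₁ q⋖y)
      from (inj₂ (_ , ℕ.s≤s ()))
    position-of-class : ∀ {x} (cx : colour x ≡ c) dx → position x dx ≡ (g.f (x , cx) , zero)
    position-of-class cx (yes _)  = cong (λ u → g.f u , zero) (class-≡ refl)
    position-of-class cx (no ¬cx) = ⊥-elim (¬cx cx)

    position-of-successor : ∀ {p s} (cp : colour p ≡ c) → p ⋖ s → colour s ≡ other c →
                            ∀ ds → position s ds ≡ (g.f (p , cp) , suc zero)
    position-of-successor cp p⋖s cs (yes cs') = ⊥-elim (other-≢ c (≡.trans (sym cs) cs'))
    position-of-successor cp p⋖s cs (no ¬cs)  =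
      cong (λ u → g.f u , suc zero) (class-≡ (⋖-functionalˡ (proj₂ (predecessor ¬cs)) p⋖s))

    position-surjective : StrictlySurjective _≡_ (λ x → position x (colour x ≟ᶜ c))
    position-surjective (q , zero) =
      let (x , cx) , gx≡q = surjective⇒strictlySurjective (proj₂ g.bijective) q
      in x , ≡.trans (position-of-class cx (colour x ≟ᶜ c)) (cong (_, zero) gx≡q)
    position-surjective (q , suc zero) =
      let (p , cp) , gp≡q = surjective⇒strictlySurjective (proj₂ g.bijective) q
          s , p⋖s , cs = transport-⋖ʳ x₀⋖y₀ (≡.trans cx₀ (sym cp))
      in s , ≡.trans (position-of-successor cp p⋖s (≡.trans cs cy₀) (colour s ≟ᶜ c))
                     (cong (_, suc zero) gp≡q)

    position-colour : ∀ x dx → ColOrd.colour (QTwo c) (position x dx) ≡ colour x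
    position-colour x (yes cx)  = sym cx
    position-colour x (no ¬cx) = sym (≢⇒≡other (¬cx ∘ sym))

    colOrd≅QTwo : colOrd ≅ QTwo c
    colOrd≅QTwo = colOrd≅ {f = λ x → position x (colour x ≟ᶜ c)}
      (λ x y → position-pres x y (colour x ≟ᶜ c) (colour y ≟ᶜ c))
      position-surjective
      (λ x → position-colour x (colour x ≟ᶜ c))

  module GenericColouring (noMax : ∀ x → ∃[ y ] x < y) (noMin : ∀ x → ∃[ y ] y < x) (x₀ : X)
                 (both-colours : ∀ {x y} → x < y → ∀ d → ∃[ z ] x < z × z < y × colour z ≡ d) where
    X-countableDLO : CountableDLO
    X-countableDLO = record
      { Carrier            = X
      ; _<_                = _<_
      ; isDenseLinearOrder = record
        { isStrictTotalOrder = isStrictTotalOrder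
        ; dense              = λ x<y → let z , x<z , z<y , _ = both-colours x<y red in z , x<z , z<y
        }
      ; noMax            = noMax
      ; noMin            = noMin
      ; point            = x₀
      ; encode           = proj₁ countable
      ; encode-injective = proj₂ countable
      }

    private
      X≅ℚ : ∃ (IsOrderIsomorphism _≡_ _≡_ _<_ ℚ._<_)
      X≅ℚ = BackAndForth.cantor em X-countableDLO ℚ-countableDLO

      f : X → ℚ
      f = proj₁ X≅ℚ
      open IsOrderIsomorphism (proj₂ X≅ℚ) using (mono; cancel; injective; surjective)

      f-onto : StrictlySurjective _≡_ f
      f-onto = surjective⇒strictlySurjective surjective

    χ : ℚ → Colour
    χ q = colour (proj₁ (f-onto q))

    χ-f : ∀ x → χ (f x) ≡ colour x
    χ-f x = cong colour (injective (proj₂ (f-onto (f x))))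

    χ-generic : IsGenericColouring χ
    χ-generic p q p<q d =
      let x , fx≡p = f-onto p
          y , fy≡q = f-onto q
          z , x<z , z<y , cz = both-colours (cancel (subst₂ ℚ._<_ (sym fx≡p) (sym fy≡q) p<q)) d
      in f z , subst (ℚ._< f z) fx≡p (mono x<z) , subst (f z ℚ.<_) fy≡q (mono z<y) , ≡.trans (χ-f z) cz

    colOrd≅QCol : colOrd ≅ QCol χ
    colOrd≅QCol = toColIso (proj₂ X≅ℚ) χ-f

  unbounded-above : (∀ c → HasTwoPoints c) → ∀ x → ∃[ y ] x < y
  unbounded-above two x = let y , x<y , _ = class-noMax (two (colour x)) refl in y , x<y

  unbounded-below : (∀ c → HasTwoPoints c) → ∀ x → ∃[ y ] y < x
  unbounded-below two x = let y , y<x , _ = class-noMin (two (colour x)) refl in y , y<x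

  no-covers⇒dense : ¬ (∃[ x ] ∃[ y ] x ⋖ y) → ∀ {x y} → x < y → ∃[ z ] x < z × z < y
  no-covers⇒dense ¬cover {x} {y} x<y = em⇒dne em λ ∄z → ¬cover (x , y , x<y , ∄z)

  both-colours-between : (∀ c d → Pattern c d) → ¬ (∃[ x ] ∃[ y ] x ⋖ y) →
                         ∀ {x y} → x < y → ∀ d → ∃[ z ] x < z × z < y × colour z ≡ d
  both-colours-between patterns ¬cover {x} {y} x<y d with colour x ≟ᶜ colour y
  ... | yes cx≡cy = fill (patterns _ d) refl (sym cx≡cy) x<y
  ... | no cx≢cy with no-covers⇒dense ¬cover x<y
  ...   | w , x<w , w<y with colour w ≟ᶜ colour x
  ...     | yes cw≡cx =
    let z , x<z , z<w , cz = fill (patterns _ d) refl cw≡cx x<w in z , x<z , <-trans z<w w<y , cz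
  ...     | no cw≢cx  =
    let z , w<z , z<y , cz = fill (patterns _ d) (≢-≢⇒≡ cx≢cy cw≢cx) refl w<y in z , <-trans x<w w<z , z<y , cz

  case-iv-vi : (∀ c → HasTwoPoints c) → OneOfTheListedOrders colOrd
  case-iv-vi two with em {SomeBelow blue red} | em {SomeBelow red blue}
  ... | no ¬br | _ = inj₂ (inj₂ (inj₂ (inj₂ (inj₂ (inj₁ (red ,
        ≅-trans (colOrd≅ClassOrd⊕ClassOrd (λ ()) (¬SomeBelow⇒AllBelow (λ ()) ¬br))
                (ClassOrd≅QMono (two red) ⊕-cong ClassOrd≅QMono (two blue))))))))
  ... | yes _ | no ¬rb = inj₂ (inj₂ (inj₂ (inj₂ (inj₂ (inj₁ (blue ,
        ≅-trans (colOrd≅ClassOrd⊕ClassOrd (λ ()) (¬SomeBelow⇒AllBelow (λ ()) ¬rb))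
                (ClassOrd≅QMono (two blue) ⊕-cong ClassOrd≅QMono (two red))))))))
  ... | yes br | yes rb with em {∃[ x ] ∃[ y ] x ⋖ y}
  ...   | yes (x , y , x⋖y) = inj₂ (inj₂ (inj₂ (inj₂ (inj₂ (inj₂ (inj₁ (colour x ,
          CoveringPairs.colOrd≅QTwo (two _) x⋖y refl)))))))
  ...   | no ¬cover = inj₂ (inj₂ (inj₂ (inj₂ (inj₂ (inj₂ (inj₂ (Q₂.χ , Q₂.χ-generic , Q₂.colOrd≅QCol)))))))
    where
    patterns : ∀ c d → Pattern c d
    patterns red  red  = monochromatic-pattern (two red)
    patterns red  blue = interleaved-pattern rb br
    patterns blue red  = interleaved-pattern br rb
    patterns blue blue = monochromatic-pattern (two blue)
    module Q₂ = GenericColouring (unbounded-above two) (unbounded-below two) (proj₁ (two red))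
                                 (both-colours-between patterns ¬cover)

lemma2p1 : ExcludedMiddle 0ℓ →
    (G : OrderedBipartiteGraph) →
    OrderedBipartiteGraph.X G →
    OrderedBipartiteGraph.Countable G →
    OrderedBipartiteGraph.Homogeneous G →
    OneOfTheListedOrders (OrderedBipartiteGraph.colOrd G)
lemma2p1 em G x₀ countable homogeneous = by-class-sizes em em
  where
  open Classification em G countable homogeneous

  by-class-sizes : Dec (HasTwoPoints red) → Dec (HasTwoPoints blue) → OneOfTheListedOrders colOrd
  by-class-sizes (yes two-red) (yes two-blue) = case-iv-vi λ { red → two-red ; blue → two-blue }
  by-class-sizes (yes two-red) (no lonely)    = case-ii-iii two-red lonely
  by-class-sizes (no lonely)   (yes two-blue) = case-ii-iii two-blue lonely
  by-class-sizes (no lonely-red) (no lonely-blue) = case-i (λ { red → lonely-red ; blue → lonely-blue }) x₀
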